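{- Let $G$ be an infinite group, $\mathcal{I}$ a proper translation invariant ideal of $G$, $A$ a subset of $G$ and $F$ a finite subset of $G$. If $FA=_{\mathcal{I}}G$ then $F\Delta_{\mathcal{I}}(A)=G$. In particular, if $A$ is $\mathcal{I}$-large then $A$ is $\Delta_{\mathcal{I}}$-large.
   Context: A family $\mathcal{I}\subseteq\mathcal{P}(G)$ is an ideal if it is closed under taking subsets and finite unions; it is translation invariant if $gI=\{gi: i\in I\}\in\mathcal{I}$ for all $I\in\mathcal{I}$, $g\in G$; it is proper if $G\notin\mathcal{I}$. For subsets $A,B\subseteq G$ write $A=_{\mathcal{I}}B$ if the symmetric difference $A\triangle B\in\mathcal{I}$. For $F,A\subseteq G$, $FA=\{fa: f\in F,a\in A\}$. A subset $A$ is $\mathcal{I}$-large if there is a finite $F\subseteq G$ with $FA=_{\mathcal{I}}G$. Define $\Delta_{\mathcal{I}}(A)=\{g\in G: gA\cap A\notin\mathcal{I}\}$, and call $A$ $\Delta_{\mathcal{I}}$-large if $\Delta_{\mathcal{I}}(A)$ is $\mathcal{I}$-large. -}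

module Defs where

open import Level using (Level; _⊔_; Lift; suc)
open import Algebra.Bundles using (Group)
open import Data.Product using (Σ; ∃; _×_; _,_)
open import Data.Sum using (_⊎_)
open import Data.Unit.Polymorphic using (⊤)
open import Data.List using (List)
open import Data.List.Membership.Propositional using (_∈_)
open import Relation.Nullary using (¬_)

module GroupDefs {c ℓ : Level} (G : Group c ℓ) where
  open Group G

  Subset : Set (suc (c ⊔ ℓ))
  Subset = Carrier → Set (c ⊔ ℓ)

  Univ : Subset
  Univ _ = ⊤

  _⊆_ : Subset → Subset → Set (c ⊔ ℓ)
  A ⊆ B = ∀ x → A x → B x

  _≐_ : Subset → Subset → Set (c ⊔ ℓ)
  A ≐ B = (A ⊆ B) × (B ⊆ A)

  _∪_ : Subset → Subset → Subset
  (A ∪ B) x = A x ⊎ B x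

  _∩_ : Subset → Subset → Subset
  (A ∩ B) x = A x × B x

  _△_ : Subset → Subset → Subset
  (A △ B) x = (A x × ¬ B x) ⊎ (B x × ¬ A x)

  _·_ : Carrier → Subset → Subset
  (g · A) x = ∃ λ a → A a × (x ≈ g ∙ a)

  _⋆_ : List Carrier → Subset → Subset
  (F ⋆ A) x = ∃ λ f → ∃ λ a → f ∈ F × A a × (x ≈ f ∙ a)

  Infinite : Set (c ⊔ ℓ)
  Infinite = ¬ (Σ (List Carrier) λ xs → ∀ x → ∃ λ y → y ∈ xs × (x ≈ y))

  module _ (𝓘 : Subset → Set (c ⊔ ℓ)) where

    IsIdeal : Set (suc (c ⊔ ℓ))
    IsIdeal = (∀ A B → A ⊆ B → 𝓘 B → 𝓘 A)
            × (∀ A B → 𝓘 A → 𝓘 B → 𝓘 (A ∪ B))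

    TranslationInvariant : Set (suc (c ⊔ ℓ))
    TranslationInvariant = ∀ A g → 𝓘 A → 𝓘 (g · A)

    Proper : Set (c ⊔ ℓ)
    Proper = ¬ 𝓘 Univ

    _=𝓘_ : Subset → Subset → Set (c ⊔ ℓ)
    A =𝓘 B = 𝓘 (A △ B)

    Large : Subset → Set (c ⊔ ℓ)
    Large A = Σ (List Carrier) λ F → (F ⋆ A) =𝓘 Univ

    Δ : Subset → Subset
    Δ A g = ¬ 𝓘 ((g · A) ∩ A)

    ΔLarge : Subset → Set (c ⊔ ℓ)
    ΔLarge A = Large (Δ A)

module Submission where

-- Let B = FA △ G ∈ 𝓘 and suppose some x ∈ G lies outside
-- FΔ(A), i.e. for every f ∈ F the overlap (f⁻¹x)A ∩ A belongs to 𝓘.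
-- Every a ∈ A satisfies either xa ∈ FA, say xa = f a', in which case
-- a' ∈ (f⁻¹x)A ∩ A and a = (x⁻¹f) a'; or xa ∉ FA, in which case
-- a ∈ x⁻¹B.  Hence A is covered by the finitely many translates
-- (x⁻¹f)((f⁻¹x)A ∩ A) together with x⁻¹B, so A ∈ 𝓘.  Then FA, a finite
-- union of translates of A, is in 𝓘, and G ⊆ FA ∪ B is in 𝓘,
-- contradicting properness.  So FΔ(A) = G, and the second claim follows
-- because FΔ(A) △ G is then empty.

open import Defs
open import Level using (Level; _⊔_)
open import Algebra.Bundles using (Group)
open import Data.Product using (_×_; _,_; ∃; proj₁; proj₂)
open import Data.Sum using (inj₁; inj₂)
open import Data.List using (List; []; _∷_)
open import Data.List.Membership.Propositional using (_∈_)
open import Data.List.Relation.Unary.Any using (here; there)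
open import Relation.Binary.PropositionalEquality using () renaming (refl to ≡-refl)
open import Relation.Nullary using (yes; no)
open import Data.Empty using (⊥-elim)
open import Axiom.ExcludedMiddle using (ExcludedMiddle)
open import Axiom.DoubleNegationElimination using (em⇒dne)
import Algebra.Properties.Group as GroupProperties

module GroupFacts {c ℓ : Level} (G : Group c ℓ) where
  open Group G
  open GroupProperties G using (\\-leftDividesˡ; y≈x\\z)

  factor-through : ∀ f x → x ≈ f ∙ (f ⁻¹ ∙ x)
  factor-through f x = sym (\\-leftDividesˡ f x)

  solve-right : ∀ u v a b → u ∙ a ≈ v ∙ b → b ≈ (v ⁻¹ ∙ u) ∙ a
  solve-right u v a b e = trans (y≈x\\z v b (u ∙ a) (sym e)) (sym (assoc (v ⁻¹) u a))

module FiniteUnion {c ℓ : Level} (G : Group c ℓ) where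
  open Group G using (Carrier)
  open GroupDefs G using (Subset)

  ⋃ : List Carrier → (Carrier → Subset) → Subset
  ⋃ F P y = ∃ λ f → f ∈ F × P f y

module IdealFacts {c ℓ : Level} (G : Group c ℓ) (𝓘 : GroupDefs.Subset G → Set (c ⊔ ℓ))
  (ideal : GroupDefs.IsIdeal G 𝓘) where
  open GroupDefs G
  open FiniteUnion G

  ⊆-closed : ∀ {A B} → A ⊆ B → 𝓘 B → 𝓘 A
  ⊆-closed {A} {B} = proj₁ ideal A B

  ∪-closed : ∀ {A B} → 𝓘 A → 𝓘 B → 𝓘 (A ∪ B)
  ∪-closed {A} {B} = proj₂ ideal A B

  -- A nonempty ideal (witnessed by B) contains all finite unions of its
  -- members; the witness handles the empty union.
  ⋃-closed : ∀ {B} F P → 𝓘 B → (∀ f → f ∈ F → 𝓘 (P f)) → 𝓘 (⋃ F P)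
  ⋃-closed [] P 𝓘B small = ⊆-closed (λ { y (_ , () , _) }) 𝓘B
  ⋃-closed (f ∷ F) P 𝓘B small =
    ⊆-closed split (∪-closed (small f (here ≡-refl)) (⋃-closed F P 𝓘B (λ g g∈F → small g (there g∈F))))
    where
    split : ⋃ (f ∷ F) P ⊆ (P f ∪ ⋃ F P)
    split y (_ , here ≡-refl , p) = inj₁ p
    split y (g , there g∈F , p) = inj₂ (g , g∈F , p)

  ≐⇒=𝓘 : ∀ {B S T} → 𝓘 B → S ≐ T → _=𝓘_ 𝓘 S T
  ≐⇒=𝓘 {S = S} {T} 𝓘B (S⊆T , T⊆S) = ⊆-closed empty 𝓘B
    where
    empty : (S △ T) ⊆ _
    empty y (inj₁ (Sy , ¬Ty)) = ⊥-elim (¬Ty (S⊆T y Sy))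
    empty y (inj₂ (Ty , ¬Sy)) = ⊥-elim (¬Sy (T⊆S y Ty))

  -- With excluded middle: a set 𝓘-equal to G and lying in 𝓘 forces G ∈ 𝓘,
  -- since G ⊆ S ∪ (S △ G).
  small-and-cofull : ExcludedMiddle (c ⊔ ℓ) → ∀ {S} → _=𝓘_ 𝓘 S Univ → 𝓘 S → 𝓘 Univ
  small-and-cofull em {S} cofull 𝓘S = ⊆-closed (λ y _ → cover y) (∪-closed 𝓘S cofull)
    where
    cover : ∀ y → (S ∪ (S △ Univ)) y
    cover y with em {S y}
    ... | yes Sy = inj₁ Sy
    ... | no ¬Sy = inj₂ (inj₂ (_ , ¬Sy))

  module _ (invariant : TranslationInvariant 𝓘) where

    ⋆-closed : ∀ F {A} → 𝓘 A → 𝓘 (F ⋆ A)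
    ⋆-closed F {A} 𝓘A = ⊆-closed regroup (⋃-closed F (λ f → f · A) 𝓘A (λ f _ → invariant A f 𝓘A))
      where
      regroup : (F ⋆ A) ⊆ ⋃ F (λ f → f · A)
      regroup y (f , a , f∈F , Aa , y≈fa) = f , f∈F , a , Aa , y≈fa

module Covering {c ℓ : Level} (em : ExcludedMiddle (c ⊔ ℓ)) (G : Group c ℓ) where
  open Group G
  open GroupDefs G
  open GroupFacts G
  open FiniteUnion G

  Overlap : Subset → Carrier → Subset
  Overlap A g = (g · A) ∩ A

  translate-cover : ∀ F A x →
    A ⊆ (⋃ F (λ f → (x ⁻¹ ∙ f) · Overlap A (f ⁻¹ ∙ x)) ∪ ((x ⁻¹) · ((F ⋆ A) △ Univ)))
  translate-cover F A x a Aa with em {(F ⋆ A) (x ∙ a)}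
  -- xa = f a' gives a' = (f⁻¹x) a ∈ (f⁻¹x)A ∩ A and a = (x⁻¹f) a'.
  ... | yes (f , a' , f∈F , Aa' , xa≈fa') =
    inj₁ (f , f∈F , a' , ((a , Aa , solve-right x f a a' xa≈fa') , Aa')
         , solve-right f x a' a (sym xa≈fa'))
  -- xa ∉ FA puts xa in FA △ G, and a = x⁻¹(xa).
  ... | no xa∉FA =
    inj₂ (x ∙ a , inj₂ (_ , xa∉FA) , trans (solve-right x x a a refl) (assoc (x ⁻¹) x a))

module Theorem {c ℓ : Level} (em : ExcludedMiddle (c ⊔ ℓ)) (G : Group c ℓ)
  (𝓘 : GroupDefs.Subset G → Set (c ⊔ ℓ)) (ideal : GroupDefs.IsIdeal G 𝓘)
  (invariant : GroupDefs.TranslationInvariant G 𝓘) (proper : GroupDefs.Proper G 𝓘) where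
  open Group G
  open GroupDefs G
  open GroupFacts G
  open IdealFacts G 𝓘 ideal
  open Covering em G

  small-overlaps⇒small : ∀ F A x → _=𝓘_ 𝓘 (F ⋆ A) Univ →
    (∀ f → f ∈ F → 𝓘 (Overlap A (f ⁻¹ ∙ x))) → 𝓘 A
  small-overlaps⇒small F A x cofull small =
    ⊆-closed (translate-cover F A x)
      (∪-closed (⋃-closed F _ cofull (λ f f∈F → invariant _ (x ⁻¹ ∙ f) (small f f∈F)))
                (invariant _ (x ⁻¹) cofull))

  Δ-cover : ∀ A F → _=𝓘_ 𝓘 (F ⋆ A) Univ → (F ⋆ Δ 𝓘 A) ≐ Univ
  Δ-cover A F cofull = (λ _ _ → _) , covered
    where
    covered : Univ ⊆ (F ⋆ Δ 𝓘 A)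
    covered x _ with em {∃ λ f → f ∈ F × Δ 𝓘 A (f ⁻¹ ∙ x)}
    ... | yes (f , f∈F , large) = f , f ⁻¹ ∙ x , f∈F , large , factor-through f x
    ... | no none = ⊥-elim (proper (small-and-cofull em cofull (⋆-closed invariant F 𝓘A)))
      where
      𝓘A : 𝓘 A
      𝓘A = small-overlaps⇒small F A x cofull
             (λ f f∈F → em⇒dne em (λ notSmall → none (f , f∈F , notSmall)))

  Δ-large : ∀ A → Large 𝓘 A → ΔLarge 𝓘 A
  Δ-large A (F , cofull) = F , ≐⇒=𝓘 cofull (Δ-cover A F cofull)

lemma1 : {c ℓ : Level} → ExcludedMiddle (c ⊔ ℓ) →
    (G : Group c ℓ) → let open GroupDefs G in
    (𝓘 : Subset → Set (c ⊔ ℓ)) →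
    Infinite → IsIdeal 𝓘 → TranslationInvariant 𝓘 → Proper 𝓘 →
    (A : Subset) →
    ((F : List (Group.Carrier G)) → _=𝓘_ 𝓘 (F ⋆ A) Univ → (F ⋆ Δ 𝓘 A) ≐ Univ)
    × (Large 𝓘 A → ΔLarge 𝓘 A)
lemma1 em G 𝓘 _ ideal invariant proper A = Δ-cover A , Δ-large A
  where open Theorem em G 𝓘 ideal invariant proper
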